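{- Let $1 \le t_1 < \cdots < t_k < n$ be integers and $G = G_n\langle t_1, \ldots, t_k\rangle$. Then there is a maximum clique of $G$ that contains the vertex $1$.
   Context: For integers $1 \le t_1 < \cdots < t_k < n$, the Toeplitz graph $G_n\langle t_1, \ldots, t_k\rangle$ is the simple graph with vertex set $\{1, \ldots, n\}$ in which distinct vertices $i,j$ are adjacent iff $|i-j| \in \{t_1, \ldots, t_k\}$. -}

module Defs where

open import Data.Nat using (ℕ; _≤_; _<_; ∣_-_∣)
open import Data.List using (List; length; [])
open import Data.List.Membership.Propositional using (_∈_)
open import Data.List.Relation.Unary.All using (All)
open import Data.List.Relation.Unary.AllPairs using (AllPairs)
open import Data.List.Relation.Unary.Linked using (Linked)
open import Data.Product using (_×_)
open import Relation.Binary.PropositionalEquality using (_≢_)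

ValidParams : ℕ → List ℕ → Set
ValidParams n T = T ≢ [] × Linked _<_ T × All (λ t → 1 ≤ t × t < n) T

IsVertex : ℕ → ℕ → Set
IsVertex n i = 1 ≤ i × i ≤ n

Adj : List ℕ → ℕ → ℕ → Set
Adj T i j = i ≢ j × ∣ i - j ∣ ∈ T

-- A clique of G_n⟨T⟩, given as a list of vertices that are pairwise adjacent
-- (hence pairwise distinct, so the list represents a set of size = length).
IsClique : ℕ → List ℕ → List ℕ → Set
IsClique n T C = All (IsVertex n) C × AllPairs (Adj T) C

IsMaximumClique : ℕ → List ℕ → List ℕ → Set
IsMaximumClique n T C =
  IsClique n T C × (∀ (D : List ℕ) → IsClique n T D → length D ≤ length C)

{-# OPTIONS --safe #-}
module Submission where

-- Translating vertices by a constant preserves all differences |i - j|, so shifting a maximum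
-- clique down until its least vertex is 1 yields a maximum clique through 1.  A maximum clique
-- exists because every clique is a permutation of a sublist of [1, …, n], and there are only
-- finitely many such sublists.

open import Defs
open import Data.Nat using (ℕ; suc; _+_; _∸_; _≤_; _<_; ∣_-_∣; _≟_; _≤?_; s≤s; z≤n)
open import Data.Nat.Properties
  using (≤-trans; <⇒≤; <⇒≢; m≤n+m; m<n⇒0<n∸m; m+n∸n≡m; m+[n∸m]≡n; ∣m+n-m+o∣≡∣n-o∣; ∣-∣-comm; module ≤-Reasoning)
open import Data.List using (List; []; _∷_; [_]; length; map; filter; _++_; applyUpTo)
open import Data.List.Properties using (length-map; map-∘; map-id-local)
open import Data.List.Extrema.Nat using (argmax; argmax-all; f[xs]≤f[argmax]; min; argmin-sel; min≤⊤; min≤xs)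
open import Data.List.Membership.Propositional using (_∈_)
open import Data.List.Membership.Propositional.Properties
  using (∈-map⁺; ∈-++⁺ˡ; ∈-++⁺ʳ; ∈-applyUpTo⁺; ∈-filter⁺; ∈-filter⁻)
open import Data.List.Membership.Propositional.Properties.WithK using (unique∧set⇒bag)
open import Data.List.Membership.DecPropositional _≟_ using (_∈?_)
open import Data.List.Relation.Unary.All as All using (All; []; _∷_; all?)
import Data.List.Relation.Unary.All.Properties as Allₚ
open import Data.List.Relation.Unary.Any using (here; there)
open import Data.List.Relation.Unary.AllPairs as AllPairs using (AllPairs; []; _∷_; allPairs?)
open import Data.List.Relation.Unary.Unique.Propositional using (Unique)
open import Data.List.Relation.Unary.Unique.Propositional.Properties using (applyUpTo⁺₁) renaming (filter⁺ to unique-filter⁺)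
open import Data.List.Relation.Binary.Sublist.Propositional using (_⊆_; []; _∷_; _∷ʳ_)
open import Data.List.Relation.Binary.Sublist.Propositional.Properties using (filter-⊆)
open import Data.List.Relation.Binary.Permutation.Propositional using (_↭_; ↭⇒↭ₛ)
open import Data.List.Relation.Binary.Permutation.Propositional.Properties using (All-resp-↭; ↭-length)
import Data.List.Relation.Binary.Permutation.Setoid.Properties as Permutationₛ
open import Data.List.Relation.Binary.BagAndSetEquality using (_∼[_]_; bag; ∼bag⇒↭)
import Data.List.Relation.Unary.AllPairs.Properties as AllPairsₚ
open import Data.Product using (Σ; ∃-syntax; _×_; _,_; proj₁; proj₂)
open import Data.Sum using ([_,_]′)
open import Function using (_∘_; mk⇔)
open import Relation.Nullary using (Dec; ¬?; contradiction)
open import Relation.Nullary.Decidable using (_×-dec_)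
open import Relation.Binary.PropositionalEquality using (_≡_; refl; sym; cong; subst; resp₂; setoid; module ≡-Reasoning)

sublists : {A : Set} → List A → List (List A)
sublists []       = [ [] ]
sublists (x ∷ xs) = map (x ∷_) (sublists xs) ++ sublists xs

∈-sublists⁺ : {A : Set} {xs ys : List A} → xs ⊆ ys → xs ∈ sublists ys
∈-sublists⁺ []                         = here refl
∈-sublists⁺ {ys = y ∷ ys} (y ∷ʳ xs⊆ys) = ∈-++⁺ʳ (map (y ∷_) (sublists ys)) (∈-sublists⁺ xs⊆ys)
∈-sublists⁺ {xs = x ∷ _} (refl ∷ xs⊆ys) = ∈-++⁺ˡ (∈-map⁺ (x ∷_) (∈-sublists⁺ xs⊆ys))

min-∈ : ∀ x xs → min x xs ∈ x ∷ xs
min-∈ x xs = [ here , there ]′ (argmin-sel (λ y → y) x xs)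

vertices : ℕ → List ℕ
vertices n = applyUpTo suc n

∈-vertices⁺ : ∀ {n x} → IsVertex n x → x ∈ vertices n
∈-vertices⁺ {x = suc i} (_ , i<n) = ∈-applyUpTo⁺ suc i<n

vertices-unique : ∀ n → Unique (vertices n)
vertices-unique n = applyUpTo⁺₁ suc n (λ i<j _ → <⇒≢ (s≤s i<j))

Adj-sym : ∀ T {x y} → Adj T x y → Adj T y x
Adj-sym T {x} {y} (x≢y , d∈T) = x≢y ∘ sym , subst (_∈ T) (∣-∣-comm x y) d∈T

adj? : ∀ T x y → Dec (Adj T x y)
adj? T x y = ¬? (x ≟ y) ×-dec (∣ x - y ∣ ∈? T)

isClique? : ∀ n T C → Dec (IsClique n T C)
isClique? n T C = all? (λ x → (1 ≤? x) ×-dec (x ≤? n)) C ×-dec allPairs? (adj? T) C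

IsClique-resp-↭ : ∀ {n T C D} → C ↭ D → IsClique n T C → IsClique n T D
IsClique-resp-↭ {T = T} C↭D (vs , adj) =
  All-resp-↭ C↭D vs , Permutationₛ.AllPairs-resp-↭ (setoid ℕ) (Adj-sym T) (resp₂ (Adj T)) (↭⇒↭ₛ C↭D) adj

-- A clique has no repeated vertices, which upgrades its set equality with D to a permutation.
clique-↭-sublist : ∀ {n T C} → IsClique n T C → ∃[ D ] (D ⊆ vertices n × C ↭ D)
clique-↭-sublist {n} {T} {C} (vs , adj) = D , filter-⊆ (_∈? C) (vertices n) , ∼bag⇒↭ C∼D
  where
  D : List ℕ
  D = filter (_∈? C) (vertices n)
  C∼D : C ∼[ bag ] D
  C∼D = unique∧set⇒bag (AllPairs.map proj₁ adj) (unique-filter⁺ (_∈? C) (vertices-unique n))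
          (mk⇔ (λ x∈C → ∈-filter⁺ (_∈? C) (∈-vertices⁺ (All.lookup vs x∈C)) x∈C)
               (proj₂ ∘ ∈-filter⁻ (_∈? C) {xs = vertices n}))

cliques : ℕ → List ℕ → List (List ℕ)
cliques n T = filter (isClique? n T) (sublists (vertices n))

maximumClique : ∀ n T → ∃[ C ] IsMaximumClique n T C
maximumClique n T =
  C , argmax-all length ([] , []) (Allₚ.all-filter (isClique? n T) (sublists (vertices n))) , maximal
  where
  C : List ℕ
  C = argmax length [] (cliques n T)
  maximal : ∀ D → IsClique n T D → length D ≤ length C
  maximal D D-clique with D′ , D′⊆vertices , D↭D′ ← clique-↭-sublist D-clique = begin
    length D  ≡⟨ ↭-length D↭D′ ⟩
    length D′ ≤⟨ All.lookup (f[xs]≤f[argmax] [] (cliques n T)) D′∈cliques ⟩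
    length C  ∎
    where
    open ≤-Reasoning
    D′∈cliques : D′ ∈ cliques n T
    D′∈cliques = ∈-filter⁺ (isClique? n T) (∈-sublists⁺ D′⊆vertices) (IsClique-resp-↭ D↭D′ D-clique)

Adj-+⁻ : ∀ T k {x y} → Adj T (k + x) (k + y) → Adj T x y
Adj-+⁻ T k {x} {y} (k+x≢k+y , d∈T) = k+x≢k+y ∘ cong (k +_) , subst (_∈ T) (∣m+n-m+o∣≡∣n-o∣ k x y) d∈T

IsClique-+⁻ : ∀ {n T} k {C} → All (1 ≤_) C → IsClique n T (map (k +_) C) → IsClique n T C
IsClique-+⁻ {n} {T} k pos (vs , adj) =
  All.zipWith below-n (pos , Allₚ.map⁻ vs) , AllPairs.map (Adj-+⁻ T k) (AllPairsₚ.map⁻ adj)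
  where
  below-n : ∀ {x} → 1 ≤ x × IsVertex n (k + x) → IsVertex n x
  below-n {x} (1≤x , _ , k+x≤n) = 1≤x , ≤-trans (m≤n+m x k) k+x≤n

IsMaximumClique-∸ : ∀ {n T} k {C} → All (k <_) C → IsMaximumClique n T C → IsMaximumClique n T (map (_∸ k) C)
IsMaximumClique-∸ {n} {T} k {C} k<C (C-clique , maximal) =
  IsClique-+⁻ k (Allₚ.map⁺ (All.map m<n⇒0<n∸m k<C)) (subst (IsClique n T) (sym shift-back) C-clique) ,
  λ D D-clique → subst (length D ≤_) (sym (length-map (_∸ k) C)) (maximal D D-clique)
  where
  open ≡-Reasoning
  shift-back : map (k +_) (map (_∸ k) C) ≡ C
  shift-back = begin
    map (k +_) (map (_∸ k) C)  ≡⟨ map-∘ C ⟨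
    map (λ x → k + (x ∸ k)) C  ≡⟨ map-id-local (All.map (m+[n∸m]≡n ∘ <⇒≤) k<C) ⟩
    C                          ∎

shift-least-to-1 : ∀ {n T C m} → IsMaximumClique n T C → m ∈ C → All (m ≤_) C → 1 ≤ m →
  Σ (List ℕ) (λ C′ → IsMaximumClique n T C′ × 1 ∈ C′)
shift-least-to-1 {C = C} {suc k} C-max m∈C m≤C (s≤s z≤n) =
  map (_∸ k) C , IsMaximumClique-∸ k m≤C C-max , subst (_∈ map (_∸ k) C) (m+n∸n≡m 1 k) (∈-map⁺ (_∸ k) m∈C)

lemma4 : (n : ℕ) (T : List ℕ) → ValidParams n T →
    Σ (List ℕ) (λ C → IsMaximumClique n T C × 1 ∈ C)
lemma4 n []          (T≢[] , _) = contradiction refl T≢[]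
lemma4 n T@(t ∷ _) (_ , _ , (1≤t , t<n) ∷ _) with maximumClique n T
... | [] , _ , maximal = contradiction (maximal [ 1 ] singleton-clique) λ ()
  where
  singleton-clique : IsClique n T [ 1 ]
  singleton-clique = ((s≤s z≤n , ≤-trans 1≤t (<⇒≤ t<n)) ∷ []) , ([] ∷ [])
... | c ∷ cs , C-max@((C-vertices , _) , _) =
  shift-least-to-1 C-max m∈C (min≤⊤ c cs ∷ min≤xs c cs) (proj₁ (All.lookup C-vertices m∈C))
  where
  m∈C : min c cs ∈ c ∷ cs
  m∈C = min-∈ c cs
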